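{- There is a first-order interpretation $\hat\Gamma$ of $\{E\}$ in $\{E\}$ (without parameters) such that for all graphs $G$ it holds that $\hat\Gamma[G]\cong\hat G$.
   Context: Graphs are finite, nonempty, simple and undirected, viewed as structures $(V(G),E(G))$. For a graph $G$, $\hat G$ is the graph with $V(\hat G)=V(G)\cup\{v_e\mid e\in E(G)\}$, each $v_e$ a new vertex, and $E(\hat G)=\binom{V(G)}{2}\cup\{\{v,v_e\}\mid v\in V(G), e\in E(G), v\in e\}$. A first-order interpretation of $\{E\}$ in $\{E\}$ is a tuple $\Gamma=(\gamma_{app},\gamma_V(\vec y),\gamma_\approx(\vec y_1,\vec y_2),\gamma_E(\vec y_1,\vec y_2))$ of first-order formulas in the language of graphs, where $\vec y,\vec y_1,\vec y_2$ are tuples of variables of the same length $k$. It is applicable to $G$ if $G\models\gamma_{app}$, in which case $\Gamma[G]$ is the structure whose universe is $\{\vec b\in V(G)^k\mid G\models\gamma_V[\vec b]\}$ factored by the equivalence relation $\approx$ generated (reflexive, symmetric, transitive closure) by the pairs satisfying $\gamma_\approx$, and whose edge relation is $\{(\vec b_1,\vec b_2)\mid G\models\gamma_E[\vec b_1,\vec b_2]\}$ taken on equivalence classes. (The claim includes that $\hat\Gamma$ is applicable to every graph.) -}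

module Defs where

open import Data.Nat using (ℕ; suc; _+_; _<ᵇ_)
open import Data.Fin using (Fin; toℕ)
open import Data.Fin.Properties using (_≟_)
open import Data.Bool using (Bool; true; false; not; _∧_; _∨_; T)
open import Data.Bool.ListAction using (any; all)
open import Data.Vec.Functional using (Vector; _++_; _∷_)
open import Data.Product using (Σ; ∃; _×_; _,_; proj₁; proj₂)
open import Data.Sum using (_⊎_; inj₁; inj₂)
open import Data.Empty using (⊥)
open import Relation.Nullary using (¬_; does)
open import Relation.Binary using (Rel)
open import Relation.Binary.PropositionalEquality using (_≡_)
open import Relation.Binary.Construct.Closure.Equivalence using (EqClosure)
open import Function.Bundles using (_⇔_)
import Data.List as L

record Graph : Set where
  field
    size  : ℕ
    adj   : Fin (suc size) → Fin (suc size) → Bool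
    irrefl : ∀ v → adj v v ≡ false
    sym    : ∀ u v → adj u v ≡ adj v u

  Vtx : Set
  Vtx = Fin (suc size)

open Graph public

-- First-order formulas in the language {E} (with equality),
-- with free variables among Fin m (de Bruijn style).

data Formula : ℕ → Set where
  _≐_  : ∀ {m} → Fin m → Fin m → Formula m
  E    : ∀ {m} → Fin m → Fin m → Formula m
  ¬'   : ∀ {m} → Formula m → Formula m
  _∧'_ : ∀ {m} → Formula m → Formula m → Formula m
  _∨'_ : ∀ {m} → Formula m → Formula m → Formula m
  ∃'   : ∀ {m} → Formula (suc m) → Formula m   -- binds variable 0
  ∀'   : ∀ {m} → Formula (suc m) → Formula m   -- binds variable 0

eval : (G : Graph) → ∀ {m} → Formula m → (Fin m → Vtx G) → Bool
eval G (x ≐ y)  ρ = does (ρ x ≟ ρ y)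
eval G (E x y)  ρ = adj G (ρ x) (ρ y)
eval G (¬' φ)   ρ = not (eval G φ ρ)
eval G (φ ∧' ψ) ρ = eval G φ ρ ∧ eval G ψ ρ
eval G (φ ∨' ψ) ρ = eval G φ ρ ∨ eval G ψ ρ
eval G (∃' φ)   ρ = any (λ v → eval G φ (v ∷ ρ)) (L.allFin (suc (size G)))
eval G (∀' φ)   ρ = all (λ v → eval G φ (v ∷ ρ)) (L.allFin (suc (size G)))

_⊨_[_] : (G : Graph) → ∀ {m} → Formula m → (Fin m → Vtx G) → Set
G ⊨ φ [ ρ ] = T (eval G φ ρ)

record Interpretation : Set where
  field
    k    : ℕ
    γapp : Formula 0
    γV   : Formula k
    γ≈   : Formula (k + k)   -- variables: ȳ₁ (first k), ȳ₂ (last k)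
    γE   : Formula (k + k)

open Interpretation public

Applicable : Interpretation → Graph → Set
Applicable Γ G = G ⊨ γapp Γ [ (λ ()) ]

Tup : Interpretation → Graph → Set
Tup Γ G = Σ (Fin (k Γ) → Vtx G) (λ b → G ⊨ γV Γ [ b ])

R≈ : (Γ : Interpretation) (G : Graph) → Rel (Tup Γ G) _
R≈ Γ G (b₁ , _) (b₂ , _) = G ⊨ γ≈ Γ [ b₁ ++ b₂ ]

RE : (Γ : Interpretation) (G : Graph) → Rel (Tup Γ G) _
RE Γ G (b₁ , _) (b₂ , _) = G ⊨ γE Γ [ b₁ ++ b₂ ]

-- The graph Ĝ: vertex set V(G) ∪ {v_e | e ∈ E(G)}.  An edge e = {u,v}
-- is represented uniquely by the ordered pair (u , v) with u < v.

EdgeOf : Graph → Set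
EdgeOf G = Σ (Vtx G × Vtx G) λ { (u , v) → T ((toℕ u <ᵇ toℕ v) ∧ adj G u v) }

HatV : Graph → Set
HatV G = Vtx G ⊎ EdgeOf G

_∈ₑ_ : ∀ {G} → Vtx G → EdgeOf G → Set
w ∈ₑ ((u , v) , _) = (w ≡ u) ⊎ (w ≡ v)

HatAdj : (G : Graph) → HatV G → HatV G → Set
HatAdj G (inj₁ u) (inj₁ v) = ¬ (u ≡ v)
HatAdj G (inj₁ v) (inj₂ e) = _∈ₑ_ {G} v e
HatAdj G (inj₂ e) (inj₁ v) = _∈ₑ_ {G} v e
HatAdj G (inj₂ _) (inj₂ _) = ⊥

-- Since Agda (without cubical) has no quotient types, an
-- isomorphism from the quotient Tup/≈ onto Ĝ is given by a map f on
-- representatives that is surjective, whose fibres are exactly the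
-- ≈-classes (so it induces a bijection on classes), and which maps the
-- induced edge relation on classes ([x] E [y] iff some representatives
-- x' ≈ x, y' ≈ y satisfy γE) exactly onto the edges of Ĝ.

record IsoHat (Γ : Interpretation) (G : Graph) : Set where
  field
    f        : Tup Γ G → HatV G
    surj     : ∀ w → ∃ λ x → f x ≡ w
    classes  : ∀ x y → (f x ≡ f y) ⇔ EqClosure (R≈ Γ G) x y
    edges    : ∀ x y → HatAdj G (f x) (f y) ⇔
                 (∃ λ x' → ∃ λ y' → EqClosure (R≈ Γ G) x x'
                                    × EqClosure (R≈ Γ G) y y'
                                    × RE Γ G x' y')

-- A vertex of Ĝ is coded by a pair (a , c) of vertices of G with a = c or a ~ c:
-- the diagonal pair (a , a) codes the old vertex a and an adjacent pair codes the
-- new vertex v_{ac}.  Two codes denote the same vertex of Ĝ exactly when they agree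
-- as unordered pairs, and two codes are adjacent in Ĝ exactly when they are two
-- distinct diagonal pairs, or a diagonal pair (a , a) and an adjacent pair
-- containing a; both conditions only use equality of vertices.
module Submission where

open import Defs
open import Data.Nat using (_<_)
open import Data.Nat.Properties using (<-cmp; <⇒<ᵇ; <ᵇ⇒<; <-asym; <-irrefl)
open import Data.Fin using (Fin; toℕ; zero; suc)
open import Data.Fin.Properties using (_≟_; toℕ-injective)
open import Data.Bool using (true; false; not; _∧_; _∨_; T)
open import Data.Bool.Properties using (T-∧; T-∨; T-irrelevant)
open import Data.Vec.Functional using (_∷_; [])
open import Data.Product using (Σ; ∃; _×_; _,_; proj₁; proj₂)
open import Data.Product.Function.NonDependent.Propositional using (_×-⇔_)
open import Data.Sum using (_⊎_; inj₁; inj₂; swap)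
open import Data.Sum.Properties using (inj₁-injective; inj₂-injective)
open import Data.Sum.Function.Propositional using (_⊎-⇔_)
open import Data.Unit using (tt)
open import Function using (_∘_; id; const)
open import Function.Bundles using (_⇔_; mk⇔; Equivalence)
open import Function.Related.TypeIsomorphisms using (¬-cong-⇔)
open import Function.Properties.Equivalence using () renaming (trans to ⇔-trans; sym to ⇔-sym)
open import Relation.Nullary using (¬_; Dec; does; yes; no; contradiction)
open import Relation.Binary.PropositionalEquality as ≡ using (_≡_; _≢_; refl; cong; subst; subst₂)
open import Relation.Binary.Definitions using (tri<; tri≈; tri>)
open import Relation.Binary.Construct.Closure.Equivalence using (EqClosure; gfold; return)
open import Relation.Binary.Construct.Closure.ReflexiveTransitive using (ε)

open Equivalence using (to; from)

UnorderedEq : ∀ {A : Set} → A × A → A × A → Set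
UnorderedEq (a , c) (a' , c') = (a ≡ a' × c ≡ c') ⊎ (a ≡ c' × c ≡ a')

T-does : ∀ {p} {P : Set p} (P? : Dec P) → T (does P?) ⇔ P
T-does (yes p) = mk⇔ (const p) (const tt)
T-does (no ¬p) = mk⇔ (λ ()) ¬p

T-not : ∀ {b} → T (not b) ⇔ (¬ T b)
T-not {true}  = mk⇔ (λ ()) (λ ¬⊤ → ¬⊤ tt)
T-not {false} = mk⇔ (λ _ ()) (const tt)

T-∨-falseʳ : ∀ {b} → T (b ∨ false) ⇔ T b
T-∨-falseʳ {true}  = mk⇔ id id
T-∨-falseʳ {false} = mk⇔ id id

isoHat-byKernel : (Γ : Interpretation) (G : Graph) (f : Tup Γ G → HatV G)
                → (∀ w → ∃ λ x → f x ≡ w)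
                → (∀ x y → f x ≡ f y ⇔ R≈ Γ G x y)
                → (∀ x y → HatAdj G (f x) (f y) ⇔ RE Γ G x y)
                → IsoHat Γ G
isoHat-byKernel Γ G f surj kernel adjacency = record
  { f       = f
  ; surj    = surj
  ; classes = λ x y → mk⇔ (return ∘ to (kernel x y)) respects
  ; edges   = λ x y → mk⇔ (λ h → x , y , ε , ε , to (adjacency x y) h) pullback
  }
  where
  respects : ∀ {x y} → EqClosure (R≈ Γ G) x y → f x ≡ f y
  respects = gfold ≡.isEquivalence f (from (kernel _ _))

  pullback : ∀ {x y} → (∃ λ x' → ∃ λ y' → EqClosure (R≈ Γ G) x x' × EqClosure (R≈ Γ G) y y' × RE Γ G x' y')
           → HatAdj G (f x) (f y)
  pullback (x' , y' , x≈x' , y≈y' , e) =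
    subst₂ (HatAdj G) (≡.sym (respects x≈x')) (≡.sym (respects y≈y')) (from (adjacency x' y') e)

infix 1 if'_then_else_

if'_then_else_ : ∀ {m} → Formula m → Formula m → Formula m → Formula m
if' φ then ψ else χ = (φ ∧' ψ) ∨' (¬' φ ∧' χ)

x₀ x₁ y₀ y₁ : Fin 4
x₀ = zero
x₁ = suc zero
y₀ = suc (suc zero)
y₁ = suc (suc (suc zero))

Γ̂ : Interpretation
Γ̂ = record
  { k    = 2
  ; γapp = ∃' (zero ≐ zero)
  ; γV   = (zero ≐ suc zero) ∨' E zero (suc zero)
  ; γ≈   = ((x₀ ≐ y₀) ∧' (x₁ ≐ y₁)) ∨' ((x₀ ≐ y₁) ∧' (x₁ ≐ y₀))
  ; γE   = if' x₀ ≐ x₁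
             then (if' y₀ ≐ y₁ then ¬' (x₀ ≐ y₀) else ((x₀ ≐ y₀) ∨' (x₀ ≐ y₁)))
             else (if' y₀ ≐ y₁ then ((y₀ ≐ x₀) ∨' (y₀ ≐ x₁)) else ¬' (x₀ ≐ x₀))
  }

-- γapp is ∃x. x = x, which holds at vertex zero of the nonempty graph.
Γ̂-applicable : (G : Graph) → Applicable Γ̂ G
Γ̂-applicable G = tt

module _ (G : Graph) where

  private
    _∈_ : Vtx G → EdgeOf G → Set
    w ∈ e = _∈ₑ_ {G} w e

  ends-< : (e : EdgeOf G) → toℕ (proj₁ (proj₁ e)) < toℕ (proj₂ (proj₁ e))
  ends-< ((u , v) , t) = <ᵇ⇒< (toℕ u) (toℕ v) (proj₁ (to T-∧ t))

  edge : (a c : Vtx G) → a ≢ c → T (adj G a c) → EdgeOf G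
  edge a c a≢c a~c with <-cmp (toℕ a) (toℕ c)
  ... | tri< a<c _ _ = (a , c) , from T-∧ (<⇒<ᵇ a<c , a~c)
  ... | tri≈ _ a=c _ = contradiction (toℕ-injective a=c) a≢c
  ... | tri> _ _ c<a = (c , a) , from T-∧ (<⇒<ᵇ c<a , subst T (Graph.sym G a c) a~c)

  ∈-edge : ∀ {a c} a≢c a~c w → w ∈ edge a c a≢c a~c ⇔ (w ≡ a ⊎ w ≡ c)
  ∈-edge {a} {c} a≢c a~c w with <-cmp (toℕ a) (toℕ c)
  ... | tri< _ _ _   = mk⇔ id id
  ... | tri≈ _ a=c _ = contradiction (toℕ-injective a=c) a≢c
  ... | tri> _ _ _   = mk⇔ swap swap

  edge-ext : (e e' : EdgeOf G) → (∀ w → w ∈ e → w ∈ e') → e ≡ e'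
  edge-ext e@((u , v) , t) e'@((u' , v') , t') e⊆e'
    with e⊆e' u (inj₁ refl) | e⊆e' v (inj₂ refl)
  ... | inj₁ refl | inj₂ refl = cong (_ ,_) (T-irrelevant t t')
  ... | inj₁ refl | inj₁ refl = contradiction (ends-< e) (<-irrefl refl)
  ... | inj₂ refl | inj₁ refl = contradiction (ends-< e) (<-asym (ends-< e'))
  ... | inj₂ refl | inj₂ refl = contradiction (ends-< e) (<-irrefl refl)

  edge-comm : ∀ {a c} a≢c a~c c≢a c~a → edge a c a≢c a~c ≡ edge c a c≢a c~a
  edge-comm {a} {c} a≢c a~c c≢a c~a =
    edge-ext _ _ λ w → from (∈-edge c≢a c~a w) ∘ swap ∘ to (∈-edge a≢c a~c w)

  edge-canonical : (e : EdgeOf G) → ∀ u≢v u~v → edge (proj₁ (proj₁ e)) (proj₂ (proj₁ e)) u≢v u~v ≡ e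
  edge-canonical ((u , v) , _) u≢v u~v = edge-ext _ _ λ w → to (∈-edge u≢v u~v w)

  edge-injective : ∀ {a c a' c'} a≢c a~c a'≢c' a'~c' → edge a c a≢c a~c ≡ edge a' c' a'≢c' a'~c'
                 → UnorderedEq (a , c) (a' , c')
  edge-injective {a} {c} {a'} {c'} a≢c a~c a'≢c' a'~c' e=e'
    with ends-match a (inj₁ refl) | ends-match c (inj₂ refl)
    where
    ends-match : ∀ w → w ≡ a ⊎ w ≡ c → w ≡ a' ⊎ w ≡ c'
    ends-match w = to (∈-edge a'≢c' a'~c' w) ∘ subst (w ∈_) e=e' ∘ from (∈-edge a≢c a~c w)
  ... | inj₁ a=a' | inj₂ c=c' = inj₁ (a=a' , c=c')
  ... | inj₂ a=c' | inj₁ c=a' = inj₂ (a=c' , c=a')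
  ... | inj₁ a=a' | inj₁ c=a' = contradiction (≡.trans a=a' (≡.sym c=a')) a≢c
  ... | inj₂ a=c' | inj₂ c=c' = contradiction (≡.trans a=c' (≡.sym c=c')) a≢c

  hatOf : (a c : Vtx G) → T (does (a ≟ c) ∨ adj G a c) → HatV G
  hatOf a c p with a ≟ c
  ... | yes _   = inj₁ a
  ... | no a≢c = inj₂ (edge a c a≢c p)

  hatOf-comm : ∀ a c p p' → hatOf a c p ≡ hatOf c a p'
  hatOf-comm a c p p' with a ≟ c | c ≟ a
  ... | yes a=c | yes _   = cong inj₁ a=c
  ... | yes a=c | no c≢a = contradiction (≡.sym a=c) c≢a
  ... | no a≢c | yes c=a = contradiction (≡.sym c=a) a≢c
  ... | no a≢c | no c≢a = cong inj₂ (edge-comm a≢c p c≢a p')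

  hatOf-respects : ∀ {a c a' c'} p p' → UnorderedEq (a , c) (a' , c') → hatOf a c p ≡ hatOf a' c' p'
  hatOf-respects {a} {c} p p' (inj₁ (refl , refl)) = cong (hatOf a c) (T-irrelevant p p')
  hatOf-respects {a} {c} p p' (inj₂ (refl , refl)) = hatOf-comm a c p p'

  hatOf-injective : ∀ {a c a' c'} p p' → hatOf a c p ≡ hatOf a' c' p' → UnorderedEq (a , c) (a' , c')
  hatOf-injective {a} {c} {a'} {c'} p p' eq with a ≟ c | a' ≟ c'
  ... | yes a=c | yes a'=c' = inj₁ (a=a' , ≡.trans (≡.sym a=c) (≡.trans a=a' a'=c'))
    where a=a' = inj₁-injective eq
  ... | no a≢c | no a'≢c' = edge-injective a≢c p a'≢c' p' (inj₂-injective eq)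
  hatOf-injective p p' () | yes _ | no _
  hatOf-injective p p' () | no _  | yes _

  T-≟-∧ : ∀ {a a' c c' : Vtx G} → T (does (a ≟ a') ∧ does (c ≟ c')) ⇔ (a ≡ a' × c ≡ c')
  T-≟-∧ {a} {a'} {c} {c'} = ⇔-trans T-∧ (T-does (a ≟ a') ×-⇔ T-does (c ≟ c'))

  T-≟-∨ : ∀ {w a c : Vtx G} → T (does (w ≟ a) ∨ does (w ≟ c)) ⇔ (w ≡ a ⊎ w ≡ c)
  T-≟-∨ {w} {a} {c} = ⇔-trans T-∨ (T-does (w ≟ a) ⊎-⇔ T-does (w ≟ c))

  hatOf-adjacency : ∀ a c a' c' p p'
                  → HatAdj G (hatOf a c p) (hatOf a' c' p') ⇔ G ⊨ γE Γ̂ [ a ∷ c ∷ a' ∷ c' ∷ [] ]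
  -- Deciding a ≟ c and a' ≟ c' also decides the guards of γE, so each case
  -- leaves a single branch, possibly followed by "∨ false".
  hatOf-adjacency a c a' c' p p' with a ≟ c | a' ≟ c'
  ... | yes _ | yes _ =
    ⇔-sym (⇔-trans T-∨-falseʳ (⇔-trans T-∨-falseʳ (⇔-trans T-not (¬-cong-⇔ (T-does (a ≟ a'))))))
  ... | yes _ | no a'≢c' =
    ⇔-trans (∈-edge a'≢c' p' a) (⇔-sym (⇔-trans T-∨-falseʳ T-≟-∨))
  ... | no a≢c | yes _ =
    ⇔-trans (∈-edge a≢c p a') (⇔-sym (⇔-trans T-∨-falseʳ T-≟-∨))
  ... | no _ | no _ =
    ⇔-sym (⇔-trans T-not (mk⇔ (λ a≢a → a≢a (from (T-does (a ≟ a)) refl)) λ ()))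

  hatVertex : Tup Γ̂ G → HatV G
  hatVertex (b , p) = hatOf (b zero) (b (suc zero)) p

  hatVertex-kernel : ∀ x y → hatVertex x ≡ hatVertex y ⇔ R≈ Γ̂ G x y
  hatVertex-kernel (b , p) (b' , p') =
    ⇔-sym (⇔-trans T-∨ (⇔-trans (T-≟-∧ ⊎-⇔ T-≟-∧) (mk⇔ (hatOf-respects p p') (hatOf-injective p p'))))

  hatVertex-adjacency : ∀ x y → HatAdj G (hatVertex x) (hatVertex y) ⇔ RE Γ̂ G x y
  hatVertex-adjacency (b , p) (b' , p') = hatOf-adjacency (b zero) (b (suc zero)) (b' zero) (b' (suc zero)) p p'

  hatOf-diagonal : ∀ v p → hatOf v v p ≡ inj₁ v
  hatOf-diagonal v p with v ≟ v
  ... | yes _   = refl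
  ... | no v≢v = contradiction refl v≢v

  hatOf-edge : (e : EdgeOf G) → ∀ p → hatOf (proj₁ (proj₁ e)) (proj₂ (proj₁ e)) p ≡ inj₂ e
  hatOf-edge e@((u , v) , _) p with u ≟ v
  ... | yes u=v = contradiction (ends-< e) (<-irrefl (cong toℕ u=v))
  ... | no u≢v = cong inj₂ (edge-canonical e u≢v p)

  hatVertex-surjective : ∀ w → ∃ λ x → hatVertex x ≡ w
  hatVertex-surjective (inj₁ v) = (v ∷ v ∷ [] , v=v) , hatOf-diagonal v v=v
    where
    v=v : T (does (v ≟ v) ∨ adj G v v)
    v=v = from T-∨ (inj₁ (from (T-does (v ≟ v)) refl))
  hatVertex-surjective (inj₂ e@((u , v) , u<v∧u~v)) = (u ∷ v ∷ [] , u~v) , hatOf-edge e u~v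
    where
    u~v : T (does (u ≟ v) ∨ adj G u v)
    u~v = from (T-∨ {does (u ≟ v)}) (inj₂ (proj₂ (to T-∧ u<v∧u~v)))

mainTheorem7 : Σ Interpretation (λ Γ → (G : Graph) → Applicable Γ G × IsoHat Γ G)
mainTheorem7 = Γ̂ , λ G →
  Γ̂-applicable G ,
  isoHat-byKernel Γ̂ G (hatVertex G) (hatVertex-surjective G) (hatVertex-kernel G) (hatVertex-adjacency G)
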